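{- The set $\{2,11\}\subseteq\mathbb{YF}$ is first-order definable in $(\mathbb{YF},\geqslant)$.
   Context: $\mathbb{YF}$ is the set of all finite words (including the empty word $\varepsilon$) over $\{1,2\}$. For a word $v$, $\#v$ is its length and $d(v)$ the number of letters $2$. Order: write $x=x'w$, $y=y'w$ with $w$ the longest common suffix; then $y\geqslant x$ iff $d(y')\geqslant\#x'$. A set is first-order definable if there is a first-order formula $\phi(x)$ in the language $\{\geqslant\}$ (without parameters) whose set of satisfying elements is exactly that set. -}

module Defs where

open import Data.Nat using (ℕ; zero; suc; _≤_)
open import Data.Fin using (Fin)
open import Data.List using (List; []; _∷_; length; reverse)
open import Data.Product using (_×_; _,_; Σ; proj₁; proj₂)
open import Data.Sum using (_⊎_)
open import Data.Empty using (⊥)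
open import Relation.Nullary using (¬_)
open import Relation.Binary.PropositionalEquality using (_≡_)

data Letter : Set where
  one two : Letter

-- words over {1,2}, written left to right (a list's head is the first letter)
YF : Set
YF = List Letter

d : YF → ℕ
d []          = 0
d (one ∷ v)   = d v
d (two ∷ v)   = suc (d v)

#_ : YF → ℕ
# v = length v

stripCommon : List Letter → List Letter → List Letter × List Letter
stripCommon (one ∷ as) (one ∷ bs) = stripCommon as bs
stripCommon (two ∷ as) (two ∷ bs) = stripCommon as bs
stripCommon as         bs         = as , bs

-- x = x' w, y = y' w with w the longest common suffix; returns (x' , y')
-- (computed by stripping the longest common prefix of the reversals)
primes : YF → YF → YF × YF
primes x y with stripCommon (reverse x) (reverse y)
... | rx , ry = reverse rx , reverse ry

_⩾_ : YF → YF → Set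
y ⩾ x = # proj₁ (primes x y) ≤ d (proj₂ (primes x y))

-- First-order logic in the language {⩾} (with equality), de Bruijn style:
-- a  Formula n  has free variables among  Fin n.

data Formula : ℕ → Set where
  _⩾'_ : ∀ {n} → Fin n → Fin n → Formula n
  _≐_  : ∀ {n} → Fin n → Fin n → Formula n
  ⊥'   : ∀ {n} → Formula n
  ¬'_  : ∀ {n} → Formula n → Formula n
  _∧'_ : ∀ {n} → Formula n → Formula n → Formula n
  _∨'_ : ∀ {n} → Formula n → Formula n → Formula n
  _⇒'_ : ∀ {n} → Formula n → Formula n → Formula n
  ∃'_  : ∀ {n} → Formula (suc n) → Formula n
  ∀'_  : ∀ {n} → Formula (suc n) → Formula n

_∷ₑ_ : ∀ {n} → YF → (Fin n → YF) → (Fin (suc n) → YF)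
(a ∷ₑ ρ) Fin.zero    = a
(a ∷ₑ ρ) (Fin.suc i) = ρ i

Sat : ∀ {n} → Formula n → (Fin n → YF) → Set
Sat (i ⩾' j) ρ = ρ i ⩾ ρ j
Sat (i ≐ j)  ρ = ρ i ≡ ρ j
Sat ⊥'       ρ = ⊥
Sat (¬' φ)   ρ = ¬ Sat φ ρ
Sat (φ ∧' ψ) ρ = Sat φ ρ × Sat ψ ρ
Sat (φ ∨' ψ) ρ = Sat φ ρ ⊎ Sat ψ ρ
Sat (φ ⇒' ψ) ρ = Sat φ ρ → Sat ψ ρ
Sat (∃' φ)   ρ = Σ YF λ a → Sat φ (a ∷ₑ ρ)
Sat (∀' φ)   ρ = (a : YF) → Sat φ (a ∷ₑ ρ)

FODefinable : (YF → Set) → Set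
FODefinable S =
  Σ (Formula 1) λ φ → (x : YF) → (Sat φ (λ _ → x) → S x) × (S x → Sat φ (λ _ → x))

W2 W11 : YF
W2  = two ∷ []
W11 = one ∷ one ∷ []

S-2-11 : YF → Set
S-2-11 x = (x ≡ W2) ⊎ (x ≡ W11)

-- The empty word is the least element and 1 is the only atom, since its
-- lower set is {ε, 1}. The defining formula says that x is neither least nor an
-- atom while everything below x is x, least or an atom: x has height two.
-- Since y ⩾ x forces #x ≤ #y (x = x'w, y = y'w and #x' ≤ d(y') ≤ #y'), the
-- lower sets of 2 and 11 are found among words of length at most two; they
-- are {ε, 1, 2} and {ε, 1, 11}. Conversely every word of length at least two
-- lies above 2 (if it ends in 2) or above 11 (if it ends in 11 or 21), and
-- elements of height two form an antichain.
module Submission where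

open import Defs
open import Data.Nat using (suc; _≤_; _+_; z≤n; s≤s)
open import Data.Nat.Properties using (+-comm; ≤-trans; n≤1+n; +-monoˡ-≤; module ≤-Reasoning)
open import Data.Fin using (Fin; zero; suc)
open import Data.List using (List; []; _∷_; length; reverse; _++_)
open import Data.List.Properties using (length-++; length-reverse; reverse-++; reverse-involutive; unfold-reverse)
open import Data.Product using (Σ; _×_; _,_; proj₁; proj₂)
open import Data.Sum using (_⊎_; inj₁; inj₂)
open import Data.Empty using (⊥-elim)
open import Function using (case_of_)
open import Relation.Nullary using (¬_)
open import Relation.Binary.PropositionalEquality using (_≡_; refl; sym; cong; subst; module ≡-Reasoning)

W1 : YF
W1 = one ∷ []

d-++ : ∀ u v → d (u ++ v) ≡ d u + d v
d-++ []        v = refl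
d-++ (one ∷ u) v = d-++ u v
d-++ (two ∷ u) v = cong suc (d-++ u v)

d-reverse : ∀ v → d (reverse v) ≡ d v
d-reverse []      = refl
d-reverse (a ∷ v) = begin
  d (reverse (a ∷ v))       ≡⟨ cong d (unfold-reverse a v) ⟩
  d (reverse v ++ a ∷ [])   ≡⟨ d-++ (reverse v) (a ∷ []) ⟩
  d (reverse v) + d (a ∷ []) ≡⟨ cong (_+ d (a ∷ [])) (d-reverse v) ⟩
  d v + d (a ∷ [])          ≡⟨ +-comm (d v) (d (a ∷ [])) ⟩
  d (a ∷ []) + d v          ≡⟨ sym (d-++ (a ∷ []) v) ⟩
  d (a ∷ v)                 ∎
  where open ≡-Reasoning

d≤# : ∀ v → d v ≤ # v
d≤# []        = z≤n
d≤# (one ∷ v) = ≤-trans (d≤# v) (n≤1+n _)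
d≤# (two ∷ v) = s≤s (d≤# v)

stripCommon-prefix : ∀ as bs → Σ (List Letter) λ c →
  as ≡ c ++ proj₁ (stripCommon as bs) × bs ≡ c ++ proj₂ (stripCommon as bs)
stripCommon-prefix (one ∷ as) (one ∷ bs) with stripCommon-prefix as bs
... | c , p , q = one ∷ c , cong (one ∷_) p , cong (one ∷_) q
stripCommon-prefix (two ∷ as) (two ∷ bs) with stripCommon-prefix as bs
... | c , p , q = two ∷ c , cong (two ∷_) p , cong (two ∷_) q
stripCommon-prefix []         bs         = [] , refl , refl
stripCommon-prefix (one ∷ as) []         = [] , refl , refl
stripCommon-prefix (one ∷ as) (two ∷ bs) = [] , refl , refl
stripCommon-prefix (two ∷ as) []         = [] , refl , refl
stripCommon-prefix (two ∷ as) (one ∷ bs) = [] , refl , refl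

primes-commonSuffix : ∀ x y → Σ YF λ w →
  x ≡ proj₁ (primes x y) ++ w × y ≡ proj₂ (primes x y) ++ w
primes-commonSuffix x y
  with stripCommon (reverse x) (reverse y) | stripCommon-prefix (reverse x) (reverse y)
... | _ | c , p , q = reverse c , unreverse x p , unreverse y q
  where
  unreverse : ∀ v {r} → reverse v ≡ c ++ r → v ≡ reverse r ++ reverse c
  unreverse v {r} eq = begin
    v                     ≡⟨ sym (reverse-involutive v) ⟩
    reverse (reverse v)   ≡⟨ cong reverse eq ⟩
    reverse (c ++ r)      ≡⟨ reverse-++ c r ⟩
    reverse r ++ reverse c ∎
    where open ≡-Reasoning

⩾⇒#≤ : ∀ x y → y ⩾ x → # x ≤ # y
⩾⇒#≤ x y y⩾x with primes-commonSuffix x y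
... | w , x≡x'w , y≡y'w = begin
  # x                             ≡⟨ cong length x≡x'w ⟩
  # (proj₁ (primes x y) ++ w)     ≡⟨ length-++ (proj₁ (primes x y)) ⟩
  # proj₁ (primes x y) + # w      ≤⟨ +-monoˡ-≤ (# w) (≤-trans y⩾x (d≤# (proj₂ (primes x y)))) ⟩
  # proj₂ (primes x y) + # w      ≡⟨ sym (length-++ (proj₂ (primes x y))) ⟩
  # (proj₂ (primes x y) ++ w)     ≡⟨ cong length (sym y≡y'w) ⟩
  # y                             ∎
  where open ≤-Reasoning

⩾-ε : ∀ y → y ⩾ []
⩾-ε y = z≤n

⩾-W2⊎⩾-W11 : ∀ x → 2 ≤ # x → x ⩾ W2 ⊎ x ⩾ W11
⩾-W2⊎⩾-W11 x 2≤#x with reverse x | subst (2 ≤_) (sym (length-reverse x)) 2≤#x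
... | two ∷ _ ∷ _   | _ = inj₁ z≤n
... | one ∷ one ∷ _ | _ = inj₂ z≤n
... | one ∷ two ∷ r | _ = inj₂ (subst (1 ≤_) (sym (d-reverse (two ∷ r))) (s≤s z≤n))
... | []            | ()
... | _ ∷ []        | s≤s ()

IsMinimum : YF → Set
IsMinimum y = ∀ a → a ⩾ y

IsAtom : YF → Set
IsAtom y = ¬ IsMinimum y × (∀ z → y ⩾ z → z ≡ y ⊎ IsMinimum z)

IsHeightTwo : YF → Set
IsHeightTwo y = ¬ IsMinimum y × ¬ IsAtom y × (∀ z → y ⩾ z → z ≡ y ⊎ (IsMinimum z ⊎ IsAtom z))

minimumᶠ : ∀ {n} → Fin n → Formula n
minimumᶠ v = ∀' (zero ⩾' suc v)

atomᶠ : ∀ {n} → Fin n → Formula n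
atomᶠ v = (¬' minimumᶠ v) ∧' (∀' ((suc v ⩾' zero) ⇒' ((zero ≐ suc v) ∨' minimumᶠ zero)))

heightTwoᶠ : Formula 1
heightTwoᶠ = (¬' minimumᶠ zero) ∧' ((¬' atomᶠ zero) ∧'
  (∀' ((suc zero ⩾' zero) ⇒' ((zero ≐ suc zero) ∨' (minimumᶠ zero ∨' atomᶠ zero)))))

atoms-antichain : ∀ {x z} → IsAtom x → IsAtom z → x ⩾ z → z ≡ x
atoms-antichain (_ , below-x) (z-notMin , _) x⩾z with below-x _ x⩾z
... | inj₁ z≡x  = z≡x
... | inj₂ zMin = ⊥-elim (z-notMin zMin)

heightTwo-antichain : ∀ {x z} → IsHeightTwo x → IsHeightTwo z → x ⩾ z → z ≡ x
heightTwo-antichain (_ , _ , below-x) (z-notMin , z-notAtom , _) x⩾z with below-x _ x⩾z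
... | inj₁ z≡x          = z≡x
... | inj₂ (inj₁ zMin)  = ⊥-elim (z-notMin zMin)
... | inj₂ (inj₂ zAtom) = ⊥-elim (z-notAtom zAtom)

W1-isAtom : IsAtom W1
W1-isAtom = (λ min → case min [] of λ ()) , below
  where
  below : ∀ z → W1 ⩾ z → z ≡ W1 ⊎ IsMinimum z
  below []            _ = inj₂ ⩾-ε
  below (one ∷ [])    _ = inj₁ refl
  below (two ∷ [])    ()
  below z@(_ ∷ _ ∷ _) h with ⩾⇒#≤ z W1 h
  ... | s≤s ()

W2-isHeightTwo : IsHeightTwo W2
W2-isHeightTwo = (λ min → case min [] of λ ())
               , (λ atom → case atoms-antichain atom W1-isAtom (s≤s z≤n) of λ ())
               , below
  where
  below : ∀ z → W2 ⩾ z → z ≡ W2 ⊎ (IsMinimum z ⊎ IsAtom z)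
  below []            _ = inj₂ (inj₁ ⩾-ε)
  below (one ∷ [])    _ = inj₂ (inj₂ W1-isAtom)
  below (two ∷ [])    _ = inj₁ refl
  below z@(_ ∷ _ ∷ _) h with ⩾⇒#≤ z W2 h
  ... | s≤s ()

W11-isHeightTwo : IsHeightTwo W11
W11-isHeightTwo = (λ min → case min [] of λ ())
                , (λ atom → case atoms-antichain atom W1-isAtom z≤n of λ ())
                , below
  where
  below : ∀ z → W11 ⩾ z → z ≡ W11 ⊎ (IsMinimum z ⊎ IsAtom z)
  below []                _ = inj₂ (inj₁ ⩾-ε)
  below (one ∷ [])        _ = inj₂ (inj₂ W1-isAtom)
  below (two ∷ [])        ()
  below (one ∷ one ∷ [])  _ = inj₁ refl
  below (one ∷ two ∷ [])  ()
  below (two ∷ one ∷ [])  ()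
  below (two ∷ two ∷ [])  ()
  below z@(_ ∷ _ ∷ _ ∷ _) h with ⩾⇒#≤ z W11 h
  ... | s≤s (s≤s ())

heightTwo⇒2-or-11 : ∀ x → IsHeightTwo x → S-2-11 x
heightTwo⇒2-or-11 []            (notMin , _)      = ⊥-elim (notMin ⩾-ε)
heightTwo⇒2-or-11 (one ∷ [])    (_ , notAtom , _) = ⊥-elim (notAtom W1-isAtom)
heightTwo⇒2-or-11 (two ∷ [])    _                 = inj₁ refl
heightTwo⇒2-or-11 x@(_ ∷ _ ∷ _) x-heightTwo with ⩾-W2⊎⩾-W11 x (s≤s (s≤s z≤n))
... | inj₁ x⩾W2  = inj₁ (sym (heightTwo-antichain x-heightTwo W2-isHeightTwo x⩾W2))
... | inj₂ x⩾W11 = inj₂ (sym (heightTwo-antichain x-heightTwo W11-isHeightTwo x⩾W11))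

2-or-11⇒heightTwo : ∀ x → S-2-11 x → IsHeightTwo x
2-or-11⇒heightTwo _ (inj₁ refl) = W2-isHeightTwo
2-or-11⇒heightTwo _ (inj₂ refl) = W11-isHeightTwo

-- Sat heightTwoᶠ (λ _ → x) unfolds definitionally to IsHeightTwo x.
mainTheorem11 : FODefinable S-2-11
mainTheorem11 = heightTwoᶠ , λ x → heightTwo⇒2-or-11 x , 2-or-11⇒heightTwo x
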